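{- Let $n \ge 3$ and let $H = \langle [h] \rangle$ be a cyclic subgroup of $\mathbb{Z}_n^*$ of order $|H| = d$, where $1 \le h \le n-1$. Then $H$ is semiregular on $\mathbb{Z}_n \setminus \{[0]\}$ (under multiplication) if and only if for every prime factor $p$ of $n$, $h$ has order $d$ modulo $p$.
   Context: $\mathbb{Z}_n^*$ is the group of units of $\mathbb{Z}_n$, acting on $\mathbb{Z}_n$ by multiplication. A group acts semiregularly on a set if every point stabilizer is trivial. For coprime integers $m, a$, "$a$ has order $k$ modulo $m$" means $a \bmod m$ has order $k$ in $\mathbb{Z}_m^*$. -}

module Defs where

open import Data.Nat using (ℕ; _*_; _^_; _≤_; _<_; ∣_-_∣)
open import Data.Nat.Divisibility using (_∣_)
open import Data.Product using (_×_)
open import Relation.Nullary using (¬_)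

ModEq : ℕ → ℕ → ℕ → Set
ModEq m a b = m ∣ ∣ a - b ∣

HasOrderMod : ℕ → ℕ → ℕ → Set
HasOrderMod m a k =
  1 ≤ k × ModEq m (a ^ k) 1 × (∀ j → 1 ≤ j → j < k → ¬ ModEq m (a ^ j) 1)

-- H = ⟨[h]⟩ = { [h]^k : k ∈ ℕ } ⊆ ℤ_n^* acts semiregularly on ℤ_n ∖ {[0]}:
-- every element of H fixing some nonzero class [x] (1 ≤ x ≤ n-1) is the identity [1].
CyclicSemiregular : ℕ → ℕ → Set
CyclicSemiregular n h =
  ∀ k x → 1 ≤ x → x < n → ModEq n (h ^ k * x) x → ModEq n (h ^ k) 1

-- Semiregularity asks that n ∣ (h^k − 1)·x with 0 < x < n force n ∣ h^k − 1.
-- Reducing k modulo d, the only obstruction is a residue 0 < r < d for which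
-- h^r − 1 shares a prime p with n; that happens exactly when h has order < d
-- modulo some p ∣ n, and then x = n / p is a nonzero class fixed by [h]^r ≠ [1].
module Submission where

open import Defs
open import Data.Nat using (ℕ; _≤_; _∸_)
open import Data.Nat.Divisibility using (_∣_)
open import Data.Nat.Coprimality using (Coprime)
open import Data.Nat.Primality using (Prime)
open import Function.Bundles using (_⇔_)

open import Data.Nat
  using (zero; suc; _+_; _*_; _^_; _<_; ∣_-_∣; s≤s; z≤n; NonZero; NonTrivial)
open import Data.Nat using (>-nonZero; >-nonZero⁻¹; ≢-nonZero; ≢-nonZero⁻¹)
open import Data.Nat.Properties
open import Data.Nat.Divisibility
open import Data.Nat.DivMod using (_%_; _/_; m≡m%n+[m/n]*n; m%n<n)
open import Data.Nat.Coprimality using (coprime-divisor)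
open import Data.Nat.Primality using (prime⇒nonTrivial)
open import Data.Nat.Primality.Factorisation using (factorise)
open import Data.Nat.ListAction using (product)
open import Data.Nat.Tactic.RingSolver using (solve-∀)
open import Data.List using ([]; _∷_)
open import Data.List.Relation.Unary.All using (_∷_)
open import Data.Product using (_,_)
open import Data.Empty using (⊥-elim)
open import Function.Bundles using (mk⇔; Equivalence)
open import Relation.Nullary using (¬_)
open import Relation.Binary.PropositionalEquality

open Equivalence using (to; from)

ModEq-1⇔∣∸1 : ∀ {m a} → 1 ≤ a → ModEq m a 1 ⇔ m ∣ a ∸ 1
ModEq-1⇔∣∸1 {m} {a} 1≤a = mk⇔ (subst (m ∣_) eq) (subst (m ∣_) (sym eq))
  where
  eq : ∣ a - 1 ∣ ≡ a ∸ 1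
  eq = m≤n⇒∣n-m∣≡n∸m 1≤a

ModEq-*⇔∣[∸1]* : ∀ {m a} x → 1 ≤ a → ModEq m (a * x) x ⇔ m ∣ (a ∸ 1) * x
ModEq-*⇔∣[∸1]* {m} {a} x 1≤a = mk⇔ (subst (m ∣_) eq) (subst (m ∣_) (sym eq))
  where
  open ≡-Reasoning
  eq : ∣ a * x - x ∣ ≡ (a ∸ 1) * x
  eq = begin
    ∣ a * x - x ∣      ≡⟨ cong (∣ a * x -_∣) (*-identityˡ x) ⟨
    ∣ a * x - 1 * x ∣  ≡⟨ m≤n⇒∣n-m∣≡n∸m (*-monoˡ-≤ x 1≤a) ⟩
    a * x ∸ 1 * x      ≡⟨ *-distribʳ-∸ x a 1 ⟨
    (a ∸ 1) * x        ∎

*∸1≡*[∸1]+∸1 : ∀ {a b} → 1 ≤ a → 1 ≤ b → a * b ∸ 1 ≡ a * (b ∸ 1) + (a ∸ 1)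
*∸1≡*[∸1]+∸1 {suc a} {suc b} _ _ = identity a b
  where
  identity : ∀ a b → b + a * suc b ≡ (b + a * b) + a
  identity = solve-∀

∸1∣^∸1 : ∀ a q → a ∸ 1 ∣ a ^ q ∸ 1
∸1∣^∸1 a       zero    = (a ∸ 1) ∣0
∸1∣^∸1 zero    (suc q) = 0 ∣0
∸1∣^∸1 a@(suc _) (suc q) =
  subst (a ∸ 1 ∣_) (sym (*∸1≡*[∸1]+∸1 (s≤s z≤n) (m^n>0 a q)))
    (∣m∣n⇒∣m+n (∣n⇒∣m*n a (∸1∣^∸1 a q)) ∣-refl)

^∸1∣^∸1 : ∀ h {d k} → d ∣ k → h ^ d ∸ 1 ∣ h ^ k ∸ 1
^∸1∣^∸1 h {d} (divides q refl) =
  subst (λ e → h ^ d ∸ 1 ∣ e ∸ 1) (trans (^-*-assoc h d q) (cong (h ^_) (*-comm d q)))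
    (∸1∣^∸1 (h ^ d) q)

-- Writing k = r + q·d, h^k − 1 = h^r·(h^(q·d) − 1) + (h^r − 1) and h^d − 1 ∣ h^(q·d) − 1.
∣[^∸1]*⇒∣[^%∸1]* : ∀ {n h d} .{{_ : NonZero h}} .{{_ : NonZero d}} → n ∣ h ^ d ∸ 1 →
                    ∀ k x → n ∣ (h ^ k ∸ 1) * x → n ∣ (h ^ (k % d) ∸ 1) * x
∣[^∸1]*⇒∣[^%∸1]* {n} {h} {d} n∣hᵈ∸1 k x n∣[hᵏ∸1]x =
  ∣m+n∣m⇒∣n (subst (n ∣_) (*-distribʳ-+ x A (h ^ r ∸ 1)) n∣[A+hʳ∸1]x) (∣m⇒∣m*n x n∣A)
  where
  r s A : ℕ
  r = k % d
  s = k / d * d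
  A = h ^ r * (h ^ s ∸ 1)
  n∣A : n ∣ A
  n∣A = ∣n⇒∣m*n (h ^ r) (∣-trans n∣hᵈ∸1 (^∸1∣^∸1 h (n∣m*n (k / d))))
  hᵏ∸1≡A+hʳ∸1 : h ^ k ∸ 1 ≡ A + (h ^ r ∸ 1)
  hᵏ∸1≡A+hʳ∸1 = begin
    h ^ k ∸ 1         ≡⟨ cong (λ e → h ^ e ∸ 1) (m≡m%n+[m/n]*n k d) ⟩
    h ^ (r + s) ∸ 1   ≡⟨ cong (_∸ 1) (^-distribˡ-+-* h r s) ⟩
    h ^ r * h ^ s ∸ 1 ≡⟨ *∸1≡*[∸1]+∸1 (m^n>0 h r) (m^n>0 h s) ⟩
    A + (h ^ r ∸ 1)   ∎
    where open ≡-Reasoning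
  n∣[A+hʳ∸1]x : n ∣ (A + (h ^ r ∸ 1)) * x
  n∣[A+hʳ∸1]x = subst (λ e → n ∣ e * x) hᵏ∸1≡A+hʳ∸1 n∣[hᵏ∸1]x

noPrimeDivisor⇒≡1 : ∀ m .{{_ : NonZero m}} → (∀ p → Prime p → ¬ p ∣ m) → m ≡ 1
noPrimeDivisor⇒≡1 m noPrime with factorise m
... | record { factors = [] ; isFactorisation = eq } = eq
... | record { factors = p ∷ ps ; isFactorisation = eq ; factorsPrime = p-prime ∷ _ } =
  ⊥-elim (noPrime p p-prime (divides (product ps) (trans eq (*-comm p (product ps)))))

noCommonPrime⇒coprime : ∀ {m c} .{{_ : NonZero m}} →
                        (∀ p → Prime p → p ∣ m → ¬ p ∣ c) → Coprime m c
noCommonPrime⇒coprime {m} noCommon {i} (i∣m , i∣c) = noPrimeDivisor⇒≡1 i {{i≢0}}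
  (λ p p-prime p∣i → noCommon p p-prime (∣-trans p∣i i∣m) (∣-trans p∣i i∣c))
  where
  i≢0 : NonZero i
  i≢0 = ≢-nonZero λ i≡0 → ≢-nonZero⁻¹ m (0∣⇒≡0 (subst (_∣ m) i≡0 i∣m))

semiregular⇒orderModPrime : ∀ {n h d} .{{_ : NonZero n}} .{{_ : NonZero h}} →
  HasOrderMod n h d → CyclicSemiregular n h → ∀ p → Prime p → p ∣ n → HasOrderMod p h d
semiregular⇒orderModPrime {n} {h} {d} (1≤d , hᵈ≡1 , minimal) semiregular p p-prime p∣n =
  1≤d , ∣-trans p∣n hᵈ≡1 , notEarlier
  where
  instance
    p-nonTrivial : NonTrivial p
    p-nonTrivial = prime⇒nonTrivial p-prime
  x : ℕ
  x = quotient p∣n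
  n≡p*x : n ≡ p * x
  n≡p*x = m∣n⇒n≡m*quotient p∣n
  1≤x : 1 ≤ x
  1≤x = >-nonZero⁻¹ x {{quotient≢0 p∣n}}
  notEarlier : ∀ j → 1 ≤ j → j < d → ¬ ModEq p (h ^ j) 1
  notEarlier j 1≤j j<d hʲ≡1[p] = minimal j 1≤j j<d (semiregular j x 1≤x (quotient-< p∣n)
    (from (ModEq-*⇔∣[∸1]* x (m^n>0 h j))
      (subst (_∣ (h ^ j ∸ 1) * x) (sym n≡p*x)
        (*-monoˡ-∣ x (to (ModEq-1⇔∣∸1 (m^n>0 h j)) hʲ≡1[p])))))

orderModPrime⇒coprime : ∀ {n h d} .{{_ : NonZero n}} .{{_ : NonZero h}} →
  (∀ p → Prime p → p ∣ n → HasOrderMod p h d) → ∀ r → 1 ≤ r → r < d → Coprime n (h ^ r ∸ 1)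
orderModPrime⇒coprime {h = h} orders r 1≤r r<d = noCommonPrime⇒coprime λ p p-prime p∣n p∣hʳ∸1 →
  let (_ , _ , minimal) = orders p p-prime p∣n
  in minimal r 1≤r r<d (from (ModEq-1⇔∣∸1 (m^n>0 h r)) p∣hʳ∸1)

orderModPrime⇒semiregular : ∀ {n h d} .{{_ : NonZero h}} →
  HasOrderMod n h d → (∀ p → Prime p → p ∣ n → HasOrderMod p h d) → CyclicSemiregular n h
orderModPrime⇒semiregular {n} {h} {d} (1≤d , hᵈ≡1 , _) orders k x 1≤x x<n hᵏx≡x =
  from (ModEq-1⇔∣∸1 (m^n>0 h k)) (∣-trans n∣hᵈ∸1 (^∸1∣^∸1 h d∣k))
  where
  instance
    d≢0 : NonZero d
    d≢0 = >-nonZero 1≤d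
    n≢0 : NonZero n
    n≢0 = >-nonZero (≤-trans (s≤s z≤n) x<n)
  n∣hᵈ∸1 : n ∣ h ^ d ∸ 1
  n∣hᵈ∸1 = to (ModEq-1⇔∣∸1 (m^n>0 h d)) hᵈ≡1
  residue≡0 : ∀ r → r < d → n ∣ (h ^ r ∸ 1) * x → r ≡ 0
  residue≡0 zero    _   _         = refl
  residue≡0 (suc r) r<d n∣[hʳ∸1]x = ⊥-elim (<⇒≱ x<n (∣⇒≤ {{>-nonZero 1≤x}}
    (coprime-divisor (orderModPrime⇒coprime orders (suc r) (s≤s z≤n) r<d) n∣[hʳ∸1]x)))
  d∣k : d ∣ k
  d∣k = m%n≡0⇒n∣m k d (residue≡0 (k % d) (m%n<n k d)
    (∣[^∸1]*⇒∣[^%∸1]* {d = d} n∣hᵈ∸1 k x (to (ModEq-*⇔∣[∸1]* x (m^n>0 h k)) hᵏx≡x)))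

lemma2p5 : (n h d : ℕ) → 3 ≤ n → 1 ≤ h → h ≤ n ∸ 1 → Coprime h n →
    HasOrderMod n h d →
    (CyclicSemiregular n h ⇔ (∀ p → Prime p → p ∣ n → HasOrderMod p h d))
lemma2p5 n h d 3≤n 1≤h _ _ orderModN =
  mk⇔ (semiregular⇒orderModPrime orderModN) (orderModPrime⇒semiregular orderModN)
  where
  instance
    n≢0 : NonZero n
    n≢0 = >-nonZero (≤-trans (s≤s z≤n) 3≤n)
    h≢0 : NonZero h
    h≢0 = >-nonZero 1≤h
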